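{- Let $(\Sigma,<)$ be a finite totally ordered alphabet and $w\in\Sigma^+$. If $(m_1,\ldots,m_k)$ is a grouping of $\mathrm{CFL}_{in}(w)$, then $$\mathrm{CFL}_{in}(w)=(\mathrm{CFL}_{in}(m_1),\ldots,\mathrm{CFL}_{in}(m_k)),$$ the concatenation of the sequences $\mathrm{CFL}_{in}(m_1),\ldots,\mathrm{CFL}_{in}(m_k)$.
   Context: Words are elements of $\Sigma^*$; $\Sigma^+$ the nonempty words. Lexicographic order $\prec$: $x\prec y$ if $x$ is a proper prefix of $y$, or $x=ras$, $y=rbt$ with $a,b\in\Sigma$, $a<b$. For nonempty $x,y$, $x\ll y$ means $x\prec y$ and $x$ not a proper prefix of $y$. $x\ge_p y$ means $y$ is a prefix of $x$. Inverse order $<_{in}$: $b<_{in}a\iff a<b$; $\prec_{in}$ the induced lexicographic order. An anti-Lyndon word is a nonempty primitive word strictly smaller for $\prec_{in}$ than all its other conjugates. $\mathrm{CFL}_{in}(w)$ is the unique sequence $(\ell_1,\ldots,\ell_h)$ of anti-Lyndon words with $w=\ell_1\cdots\ell_h$ and $\ell_1\succeq_{in}\cdots\succeq_{in}\ell_h$. An inverse Lyndon word is a $u\in\Sigma^+$ with $s\prec u$ for each nonempty proper suffix $s$ of $u$. A non-increasing maximal chain for the prefix order (PMC) in $\mathrm{CFL}_{in}(w)=(\ell_1,\ldots,\ell_h)$ is a block $\ell_r,\ldots,\ell_t$ of consecutive factors ($r\le t$) with $\ell_r\ge_p\cdots\ge_p\ell_t$, such that $\ell_r$ is not a prefix of $\ell_{r-1}$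 if $r>1$ and $\ell_{t+1}$ is not a prefix of $\ell_t$ if $t<h$; $\mathrm{CFL}_{in}(w)$ is the concatenation of its consecutive PMCs. For anti-Lyndon words $\lambda_1,\ldots,\lambda_n$ with $\lambda_i$ a prefix of $\lambda_{i-1}$ ($1<i\le n$), a grouping of $(\lambda_1,\ldots,\lambda_n)$ is a sequence $(m_1,\ldots,m_q)$ such that each $m_j$ is an inverse Lyndon word, there are indices $0=i_0<i_1<\cdots<i_q=n$ with $m_j=\lambda_{i_{j-1}+1}\cdots\lambda_{i_j}$, and $m_1\ll m_2\ll\cdots\ll m_q$. A grouping of $\mathrm{CFL}_{in}(w)$ is a sequence obtained from $\mathrm{CFL}_{in}(w)$ by replacing each PMC by a grouping of it. -}

module Defs where

open import Data.Nat using (ℕ; _≥_)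
open import Data.Fin using (Fin) renaming (_<_ to _<ᶠ_)
open import Data.List using (List; []; _∷_; _++_; concat; replicate; map; head; last)
open import Data.List.Relation.Unary.All using (All)
open import Data.List.Relation.Unary.Linked using (Linked)
open import Data.Maybe using (just)
open import Data.Product using (Σ; ∃; _×_; _,_)
open import Data.Sum using (_⊎_)
open import Relation.Binary.PropositionalEquality using (_≡_; _≢_)
open import Relation.Nullary using (¬_)

-- A finite totally ordered alphabet is (up to order isomorphism) Fin n
-- with its usual order.  Words over it:
Word : ℕ → Set
Word n = List (Fin n)

module _ {n : ℕ} where

  IsPrefix : Word n → Word n → Set
  IsPrefix x y = ∃ λ t → x ++ t ≡ y

  ProperPrefix : Word n → Word n → Set
  ProperPrefix x y = ∃ λ t → t ≢ [] × x ++ t ≡ y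

  Lex : (Fin n → Fin n → Set) → Word n → Word n → Set
  Lex R x y =
    ProperPrefix x y ⊎
    (∃ λ r → ∃ λ a → ∃ λ b → ∃ λ s → ∃ λ t →
       x ≡ r ++ (a ∷ s) × y ≡ r ++ (b ∷ t) × R a b)

  _≺_ : Word n → Word n → Set
  _≺_ = Lex _<ᶠ_

  _<in_ : Fin n → Fin n → Set
  b <in a = a <ᶠ b

  _≺in_ : Word n → Word n → Set
  _≺in_ = Lex _<in_

  _⪯in_ : Word n → Word n → Set
  x ⪯in y = x ≺in y ⊎ x ≡ y

  _≪_ : Word n → Word n → Set
  x ≪ y = x ≢ [] × y ≢ [] × x ≺ y × ¬ ProperPrefix x y

  _≥p_ : Word n → Word n → Set
  x ≥p y = IsPrefix y x

  _^^_ : Word n → ℕ → Word n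
  u ^^ k = concat (replicate k u)

  Primitive : Word n → Set
  Primitive w = w ≢ [] × ¬ (∃ λ u → ∃ λ k → k ≥ 2 × w ≡ u ^^ k)

  AntiLyndon : Word n → Set
  AntiLyndon w = w ≢ [] × Primitive w ×
    (∀ p s → w ≡ p ++ s → s ++ p ≢ w → w ≺in (s ++ p))

  IsCFLin : Word n → List (Word n) → Set
  IsCFLin w ls = concat ls ≡ w × All AntiLyndon ls × Linked (λ x y → y ⪯in x) ls

  InverseLyndon : Word n → Set
  InverseLyndon u = u ≢ [] × (∀ p s → u ≡ p ++ s → p ≢ [] → s ≢ [] → s ≺ u)

  PMCBoundary : List (Word n) → List (Word n) → Set
  PMCBoundary c d = ∀ x y → last c ≡ just x → head d ≡ just y → ¬ IsPrefix y x

  -- cs is the decomposition of the sequence ls into its consecutive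
  -- non-increasing maximal chains for the prefix order (PMCs)
  IsPMCDecomposition : List (Word n) → List (List (Word n)) → Set
  IsPMCDecomposition ls cs =
    concat cs ≡ ls ×
    All (λ c → c ≢ [] × Linked _≥p_ c) cs ×
    Linked PMCBoundary cs

  IsGrouping : List (Word n) → List (Word n) → Set
  IsGrouping λs ms =
    (∃ λ (ps : List (List (Word n))) →
       All (λ p → p ≢ []) ps × concat ps ≡ λs × map concat ps ≡ ms) ×
    All InverseLyndon ms ×
    Linked _≪_ ms

  IsGroupingOfCFL : List (Word n) → List (Word n) → Set
  IsGroupingOfCFL ls ms =
    ∃ λ (cs : List (List (Word n))) → IsPMCDecomposition ls cs ×
    ∃ λ (gs : List (List (Word n))) →
      Pointwise IsGrouping cs gs × concat gs ≡ ms
    where open import Data.List.Relation.Binary.Pointwise using (Pointwise)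

-- A grouping only cuts CFL_in(w) into consecutive blocks.  A block of
-- ≺in-non-increasing anti-Lyndon words is a factorisation of its product of the kind defining
-- CFL_in, so the statement reduces to uniqueness of CFL_in.  That in turn holds because the
-- first factor ℓ of CFL_in(w) is the longest anti-Lyndon prefix of w: an anti-Lyndon word is
-- ≺in-smaller than each of its proper suffixes, while a longer anti-Lyndon prefix ℓ c t′, with t′
-- a nonempty prefix of a later factor m, would give ℓ c t′ ≺in t′ ⪯in m ⪯in ℓ ⪯in ℓ c t′.
module Submission where

open import Defs
open import Data.Empty using (⊥-elim)
import Data.Fin.Properties as Fin
open import Data.List using (List; []; _∷_; _++_; concat; length; map)
open import Data.List.Properties
  using (++-assoc; ++-identityʳ; ++-identityˡ-unique; ++-cancelˡ; ++-conicalˡ;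
         ∷-injectiveˡ; ∷-injectiveʳ;
         length-++; length-++-comm; length-++-≤ʳ; concat-++; map-++)
open import Data.List.Relation.Binary.Lex.Core using (halt; this; next)
open import Data.List.Relation.Binary.Lex.Strict using (Lex-<; <-irreflexive; <-transitive; <-compare)
open import Data.List.Relation.Binary.Pointwise as Pointwise
  using (Pointwise; []; _∷_; Pointwise-≡⇒≡)
open import Data.List.Relation.Unary.All using (All; _∷_; lookupAny)
open import Data.List.Relation.Unary.All.Properties using (++⁻)
open import Data.List.Relation.Unary.AllPairs using (_∷_)
open import Data.List.Relation.Unary.Any as Any using (Any; here; there)
open import Data.List.Relation.Unary.Linked as Linked using (Linked; []; [-]; _∷_)
open import Data.List.Relation.Unary.Linked.Properties using (Linked⇒AllPairs)
open import Data.Nat using (ℕ; zero; suc; pred; _+_; _<_; z≤n; s≤s)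
open import Data.Nat.Induction using (<-wellFounded)
open import Data.Nat.Properties using (≤-trans; m≤n+m; +-cancelʳ-≡; +-monoʳ-<; +-monoˡ-<)
open import Data.Product using (∃; ∃₂; _×_; _,_)
open import Data.Sum as Sum using (_⊎_; inj₁; inj₂)
open import Function using (flip; id; _∘_)
open import Induction.WellFounded using (Acc; acc)
open import Level using (Level)
open import Relation.Binary using (Rel; IsStrictTotalOrder; StrictPartialOrder; tri<; tri≈; tri>)
import Relation.Binary.Construct.Flip.EqAndOrd as Flip
import Relation.Binary.Properties.StrictPartialOrder as StrictPartialOrderProperties
open import Relation.Binary.PropositionalEquality
  using (_≡_; _≢_; refl; sym; trans; cong; cong₂; subst; isEquivalence; resp₂; module ≡-Reasoning)
import Relation.Binary.Reasoning.StrictPartialOrder as StrictPartialOrderReasoning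
open import Relation.Nullary using (¬_)

private
  variable
    a ℓ : Level
    A : Set a

++-equidivisible : ∀ (x y u v : List A) → x ++ y ≡ u ++ v →
  (∃ λ t → x ++ t ≡ u × t ++ v ≡ y) ⊎ (∃ λ t → u ++ t ≡ x × t ++ y ≡ v)
++-equidivisible []      y u       v eq = inj₁ (u , refl , sym eq)
++-equidivisible (a ∷ x) y []      v eq = inj₂ (a ∷ x , refl , eq)
++-equidivisible (a ∷ x) y (b ∷ u) v eq
  with ∷-injectiveˡ eq | ++-equidivisible x y u v (∷-injectiveʳ eq)
... | refl | inj₁ (t , x++t≡u , t++v≡y) = inj₁ (t , cong (a ∷_) x++t≡u , t++v≡y)
... | refl | inj₂ (t , u++t≡x , t++y≡v) = inj₂ (t , cong (a ∷_) u++t≡x , t++y≡v)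

Linked-++⁻ : ∀ {R : Rel A ℓ} xs {ys} → Linked R (xs ++ ys) → Linked R xs × Linked R ys
Linked-++⁻ []           l       = [] , l
Linked-++⁻ (x ∷ [])     l       = [-] , Linked.tail l
Linked-++⁻ (x ∷ y ∷ xs) (r ∷ l) with Linked-++⁻ (y ∷ xs) l
... | lxs , lys = r ∷ lxs , lys

length-<-++ : ∀ (u : List A) {v} → u ≢ [] → length v < length (u ++ v)
length-<-++ []      u≢[] = ⊥-elim (u≢[] refl)
length-<-++ (_ ∷ u) {v} _ = s≤s (length-++-≤ʳ v {u})

++-conjugate-length : ∀ (x y z : List A) → x ++ y ≡ y ++ z → length x ≡ length z
++-conjugate-length x y z xy≡yz = +-cancelʳ-≡ (length y) (length x) (length z) (begin
  length x + length y  ≡⟨ length-++ x ⟨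
  length (x ++ y)      ≡⟨ cong length xy≡yz ⟩
  length (y ++ z)      ≡⟨ length-++-comm y z ⟩
  length (z ++ y)      ≡⟨ length-++ z ⟩
  length z + length y  ∎)
  where open ≡-Reasoning

module Lexicographic {a ℓ} {A : Set a} {_≺_ : Rel A ℓ}
                     (≺-isStrictTotalOrder : IsStrictTotalOrder _≡_ _≺_) where

  open IsStrictTotalOrder ≺-isStrictTotalOrder
    using () renaming (irrefl to ≺-irrefl; trans to ≺-trans; compare to ≺-compare)

  infix 4 _<ˡ_

  -- The library's inductive lexicographic order: easier to reason with than the existential
  -- _≺in_, which ≺in⇒<ˡ embeds into it.
  _<ˡ_ : Rel (List A) _
  _<ˡ_ = Lex-< _≡_ _≺_

  <ˡ-strictPartialOrder : StrictPartialOrder _ _ _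
  <ˡ-strictPartialOrder = record
    { isStrictPartialOrder = record
      { isEquivalence = isEquivalence
      ; irrefl        = <-irreflexive ≺-irrefl ∘ Pointwise.≡⇒Pointwise-≡
      ; trans         = <-transitive isEquivalence (resp₂ _≺_) ≺-trans
      ; <-resp-≈      = resp₂ _<ˡ_
      }
    }

  open StrictPartialOrder <ˡ-strictPartialOrder public
    using () renaming (asym to <ˡ-asym; irrefl to <ˡ-irrefl)
  open StrictPartialOrderProperties <ˡ-strictPartialOrder public
    using () renaming (_≤_ to _≤ˡ_; trans to ≤ˡ-trans)

  <ˡ-trichotomy : ∀ x y → x <ˡ y ⊎ x ≡ y ⊎ y <ˡ x
  <ˡ-trichotomy x y with <-compare sym ≺-compare x y
  ... | tri< x<y _ _   = inj₁ x<y
  ... | tri≈ _ x≋y _   = inj₂ (inj₁ (Pointwise-≡⇒≡ x≋y))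
  ... | tri> _ _ y<x   = inj₂ (inj₂ y<x)

  <ˡ-++-properPrefix : ∀ x {t} → t ≢ [] → x <ˡ x ++ t
  <ˡ-++-properPrefix []      {[]}    t≢[] = ⊥-elim (t≢[] refl)
  <ˡ-++-properPrefix []      {_ ∷ _} _    = halt
  <ˡ-++-properPrefix (_ ∷ x) t≢[]         = next refl (<ˡ-++-properPrefix x t≢[])

  ≤ˡ-++-prefix : ∀ x t → x ≤ˡ x ++ t
  ≤ˡ-++-prefix x []        = inj₂ (sym (++-identityʳ x))
  ≤ˡ-++-prefix x t@(_ ∷ _) = inj₁ (<ˡ-++-properPrefix x (λ ()))

  ++-monoʳ-<ˡ : ∀ r {x y} → x <ˡ y → r ++ x <ˡ r ++ y
  ++-monoʳ-<ˡ []      x<y = x<y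
  ++-monoʳ-<ˡ (_ ∷ r) x<y = next refl (++-monoʳ-<ˡ r x<y)

  ++-cancelˡ-<ˡ : ∀ r {x y} → r ++ x <ˡ r ++ y → x <ˡ y
  ++-cancelˡ-<ˡ []      x<y          = x<y
  ++-cancelˡ-<ˡ (_ ∷ r) (this a≺a)   = ⊥-elim (≺-irrefl refl a≺a)
  ++-cancelˡ-<ˡ (_ ∷ r) (next _ x<y) = ++-cancelˡ-<ˡ r x<y

  <ˡ⇒properPrefix⊎mismatch : ∀ {x y} → x <ˡ y →
    (∃ λ t → t ≢ [] × x ++ t ≡ y) ⊎ (∀ u v → x ++ u <ˡ y ++ v)
  <ˡ⇒properPrefix⊎mismatch halt         = inj₁ (_ , (λ ()) , refl)
  <ˡ⇒properPrefix⊎mismatch (this a≺b)   = inj₂ (λ _ _ → this a≺b)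
  <ˡ⇒properPrefix⊎mismatch (next refl x<y) with <ˡ⇒properPrefix⊎mismatch x<y
  ... | inj₁ (t , t≢[] , x++t≡y) = inj₁ (t , t≢[] , cong (_ ∷_) x++t≡y)
  ... | inj₂ mismatch            = inj₂ (λ u v → next refl (mismatch u v))

  <ˡ-++⇒≤ˡ : ∀ x y {u v} → length x ≡ length y → x ++ u <ˡ y ++ v → x ≤ˡ y
  <ˡ-++⇒≤ˡ []      []      _  _               = inj₂ refl
  <ˡ-++⇒≤ˡ (_ ∷ x) (_ ∷ y) _  (this a≺b)      = inj₁ (this a≺b)
  <ˡ-++⇒≤ˡ (_ ∷ x) (_ ∷ y) eq (next refl x<y) =
    Sum.map (next refl) (cong (_ ∷_)) (<ˡ-++⇒≤ˡ x y (cong pred eq) x<y)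

module _ {n : ℕ} where

  open Lexicographic (Flip.isStrictTotalOrder (Fin.<-isStrictTotalOrder {n}))

  ≺in⇒<ˡ : {x y : Word n} → x ≺in y → x <ˡ y
  ≺in⇒<ˡ (inj₁ (t , t≢[] , refl))                       = <ˡ-++-properPrefix _ t≢[]
  ≺in⇒<ˡ (inj₂ (r , _ , _ , _ , _ , refl , refl , a<b)) = ++-monoʳ-<ˡ r (this a<b)

  ⪯in⇒≤ˡ : {x y : Word n} → x ⪯in y → x ≤ˡ y
  ⪯in⇒≤ˡ = Sum.map₁ ≺in⇒<ˡ

  ^^-+ : ∀ (z : Word n) i j → z ^^ (i + j) ≡ z ^^ i ++ z ^^ j
  ^^-+ z zero    j = refl
  ^^-+ z (suc i) j = trans (cong (z ++_) (^^-+ z i j)) (sym (++-assoc z (z ^^ i) (z ^^ j)))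

  commute⇒common-power : ∀ (x y : Word n) → x ++ y ≡ y ++ x →
    ∃ λ z → ∃₂ λ i j → x ≡ z ^^ i × y ≡ z ^^ j
  commute⇒common-power x y = go x y (<-wellFounded _)
    where
    -- Euclid's algorithm: the shorter word is a prefix of the longer one, and the remainder
    -- commutes with it.
    go : ∀ (x y : Word n) → Acc _<_ (length x + length y) → x ++ y ≡ y ++ x →
         ∃ λ z → ∃₂ λ i j → x ≡ z ^^ i × y ≡ z ^^ j
    go []          y _ _ = y , 0 , 1 , refl , sym (++-identityʳ y)
    go x@(_ ∷ _) [] _ _ = x , 1 , 0 , sym (++-identityʳ x) , refl
    go x@(_ ∷ _) y@(_ ∷ _) (acc rs) xy≡yx with ++-equidivisible x y y x xy≡yx
    ... | inj₁ (v , x++v≡y , v++x≡y) =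
      let shorter = +-monoʳ-< (length x)
                      (subst ((length v <_) ∘ length) x++v≡y (length-<-++ x (λ ())))
          z , i , j , x≡zⁱ , v≡zʲ = go x v (rs shorter) (trans x++v≡y (sym v++x≡y))
      in z , i , i + j , x≡zⁱ ,
         trans (sym x++v≡y) (trans (cong₂ _++_ x≡zⁱ v≡zʲ) (sym (^^-+ z i j)))
    ... | inj₂ (v , y++v≡x , v++y≡x) =
      let shorter = +-monoˡ-< (length y)
                      (subst ((length v <_) ∘ length) y++v≡x (length-<-++ y (λ ())))
          z , i , j , v≡zⁱ , y≡zʲ = go v y (rs shorter) (trans v++y≡x (sym y++v≡x))
      in z , j + i , j ,
         trans (sym y++v≡x) (trans (cong₂ _++_ y≡zʲ v≡zⁱ) (sym (^^-+ z j i))) , y≡zʲ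

  primitive⇒¬commute : ∀ {p s : Word n} → Primitive (p ++ s) → p ≢ [] → s ≢ [] →
    p ++ s ≢ s ++ p
  primitive⇒¬commute {p} {s} (_ , not-power) p≢[] s≢[] ps≡sp with commute⇒common-power p s ps≡sp
  ... | _ , zero  , _     , p≡[] , _    = p≢[] p≡[]
  ... | _ , suc _ , zero  , _    , s≡[] = s≢[] s≡[]
  ... | z , suc i , suc j , p≡zⁱ , s≡zʲ =
    not-power (z , suc i + suc j , s≤s (≤-trans (s≤s z≤n) (m≤n+m (suc j) i)) ,
               trans (cong₂ _++_ p≡zⁱ s≡zʲ) (sym (^^-+ z (suc i) (suc j))))

  antiLyndon-<ˡ-rotation : ∀ {p s : Word n} → AntiLyndon (p ++ s) → p ≢ [] → s ≢ [] →
    p ++ s <ˡ s ++ p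
  antiLyndon-<ˡ-rotation {p} {s} (_ , prim , minimal) p≢[] s≢[] =
    ≺in⇒<ˡ (minimal p s refl (primitive⇒¬commute prim p≢[] s≢[] ∘ sym))

  antiLyndon-unbordered : ∀ {p s t : Word n} → AntiLyndon (p ++ s) → p ≢ [] → s ≢ [] → t ≢ [] →
    p ++ s ≢ s ++ t
  antiLyndon-unbordered {p} {s} {t} al p≢[] s≢[] t≢[] ps≡st = <ˡ-irrefl refl (begin-strict
    t  <⟨ t<p ⟩
    p  ≤⟨ p≤t ⟩
    t  ∎)
    where
    open StrictPartialOrderReasoning <ˡ-strictPartialOrder
    t<p : t <ˡ p
    t<p = ++-cancelˡ-<ˡ s (subst (_<ˡ s ++ p) ps≡st (antiLyndon-<ˡ-rotation al p≢[] s≢[]))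
    p≤t : p ≤ˡ t
    p≤t = <ˡ-++⇒≤ˡ p t (++-conjugate-length p s t ps≡st)
      (subst (_<ˡ t ++ s) (sym ps≡st) (antiLyndon-<ˡ-rotation (subst AntiLyndon ps≡st al) s≢[] t≢[]))

  antiLyndon-<ˡ-suffix : ∀ {p s : Word n} → AntiLyndon (p ++ s) → p ≢ [] → s ≢ [] → p ++ s <ˡ s
  antiLyndon-<ˡ-suffix {p} {s} al p≢[] s≢[] with <ˡ-trichotomy (p ++ s) s
  ... | inj₁ ps<s        = ps<s
  ... | inj₂ (inj₁ ps≡s) = ⊥-elim (p≢[] (++-identityˡ-unique p (sym ps≡s)))
  ... | inj₂ (inj₂ s<ps) with <ˡ⇒properPrefix⊎mismatch s<ps
  ...   | inj₁ (t , t≢[] , s++t≡ps) =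
    ⊥-elim (antiLyndon-unbordered al p≢[] s≢[] t≢[] (sym s++t≡ps))
  ...   | inj₂ mismatch =
    ⊥-elim (<ˡ-asym (antiLyndon-<ˡ-rotation al p≢[] s≢[])
                    (subst (s ++ p <ˡ_) (++-identityʳ (p ++ s)) (mismatch p [])))

  prefix-of-concat : ∀ {t : Word n} L → t ≢ [] → IsPrefix t (concat L) →
    ∃₂ λ c t′ → t ≡ c ++ t′ × t′ ≢ [] × Any (IsPrefix t′) L
  prefix-of-concat []      t≢[] (r , t++r≡[]) = ⊥-elim (t≢[] (++-conicalˡ _ r t++r≡[]))
  prefix-of-concat {t} (m ∷ L) t≢[] (r , t++r≡mL) with ++-equidivisible t r m (concat L) t++r≡mL
  ... | inj₁ (v , t++v≡m , _)   = [] , t , refl , t≢[] , here (v , t++v≡m)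
  ... | inj₂ ([] , m++[]≡t , _) =
    [] , t , refl , t≢[] , here ([] , trans (++-identityʳ t) (trans (sym m++[]≡t) (++-identityʳ m)))
  ... | inj₂ (v@(_ ∷ _) , m++v≡t , v++r≡L) with prefix-of-concat L (λ ()) (r , v++r≡L)
  ...   | c , t′ , v≡c++t′ , t′≢[] , t′≼L =
    m ++ c , t′ , trans (sym m++v≡t) (trans (cong (m ++_) v≡c++t′) (sym (++-assoc m c t′))) ,
    t′≢[] , there t′≼L

  tail-≤ˡ-head : ∀ {ℓ : Word n} {L} → Linked (λ x y → y ⪯in x) (ℓ ∷ L) → All (_≤ˡ ℓ) L
  tail-≤ˡ-head nonincreasing with Linked⇒AllPairs (flip ≤ˡ-trans) (Linked.map ⪯in⇒≤ˡ nonincreasing)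
  ... | L≤ℓ ∷ _ = L≤ℓ

  CFLin-head-longest : ∀ {w ℓ u : Word n} {L} → IsCFLin w (ℓ ∷ L) → IsPrefix u w → AntiLyndon u →
    ¬ ProperPrefix ℓ u
  CFLin-head-longest {ℓ = ℓ} {L = L} (refl , (ℓ≢[] , _) ∷ _ , nonincreasing) (r , ℓtr≡ℓL) ℓt-al
                     (t , t≢[] , refl)
    with prefix-of-concat L t≢[] (r , ++-cancelˡ ℓ _ _ (trans (sym (++-assoc ℓ t r)) ℓtr≡ℓL))
  ... | c , t′ , refl , t′≢[] , t′≼L with lookupAny (tail-≤ˡ-head nonincreasing) t′≼L
  ... | m≤ℓ , (v , t′++v≡m) = <ˡ-irrefl refl (begin-strict
    (ℓ ++ c) ++ t′      <⟨ antiLyndon-<ˡ-suffix ℓct′-al (ℓ≢[] ∘ ++-conicalˡ ℓ c) t′≢[] ⟩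
    t′                  ≤⟨ subst (t′ ≤ˡ_) t′++v≡m (≤ˡ-++-prefix t′ v) ⟩
    Any.lookup t′≼L     ≤⟨ m≤ℓ ⟩
    ℓ                   ≤⟨ subst (ℓ ≤ˡ_) (sym (++-assoc ℓ c t′)) (≤ˡ-++-prefix ℓ (c ++ t′)) ⟩
    (ℓ ++ c) ++ t′      ∎)
    where
    open StrictPartialOrderReasoning <ˡ-strictPartialOrder
    ℓct′-al : AntiLyndon ((ℓ ++ c) ++ t′)
    ℓct′-al = subst AntiLyndon (sym (++-assoc ℓ c t′)) ℓt-al

  CFLin-head-unique : ∀ {w ℓ ℓ′ : Word n} {L L′} → IsCFLin w (ℓ ∷ L) → IsCFLin w (ℓ′ ∷ L′) →
    ℓ ≡ ℓ′
  CFLin-head-unique {ℓ = ℓ} {ℓ′} {L} {L′} cfl@(refl , al ∷ _ , _) cfl′@(ℓ′L′≡ℓL , al′ ∷ _ , _)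
    with ++-equidivisible ℓ (concat L) ℓ′ (concat L′) (sym ℓ′L′≡ℓL)
  ... | inj₁ ([] , ℓ++[]≡ℓ′ , _) = trans (sym (++-identityʳ ℓ)) ℓ++[]≡ℓ′
  ... | inj₂ ([] , ℓ′++[]≡ℓ , _) = trans (sym ℓ′++[]≡ℓ) (++-identityʳ ℓ′)
  ... | inj₁ (t@(_ ∷ _) , ℓ++t≡ℓ′ , _) =
    ⊥-elim (CFLin-head-longest cfl (concat L′ , ℓ′L′≡ℓL) al′ (t , (λ ()) , ℓ++t≡ℓ′))
  ... | inj₂ (t@(_ ∷ _) , ℓ′++t≡ℓ , _) =
    ⊥-elim (CFLin-head-longest cfl′ (concat L , refl) al (t , (λ ()) , ℓ′++t≡ℓ))

  CFLin-unique : ∀ {w : Word n} {ls ls′} → IsCFLin w ls → IsCFLin w ls′ → ls ≡ ls′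
  CFLin-unique {ls = []}    {[]}    _ _ = refl
  CFLin-unique {ls = []}    {ℓ ∷ _} (refl , _) (ℓL≡[] , (ℓ≢[] , _) ∷ _ , _) =
    ⊥-elim (ℓ≢[] (++-conicalˡ ℓ _ ℓL≡[]))
  CFLin-unique {ls = ℓ ∷ _} {[]}    (ℓL≡[] , (ℓ≢[] , _) ∷ _ , _) (refl , _) =
    ⊥-elim (ℓ≢[] (++-conicalˡ ℓ _ ℓL≡[]))
  CFLin-unique {ls = ℓ ∷ _} {_ ∷ _} cfl@(refl , _ ∷ als , lk) cfl′@(ℓ′L′≡ℓL , _ ∷ als′ , lk′)
    with CFLin-head-unique cfl cfl′
  ... | refl = cong (ℓ ∷_) (CFLin-unique (refl , als , Linked.tail lk)
                                         (++-cancelˡ ℓ _ _ ℓ′L′≡ℓL , als′ , Linked.tail lk′))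

  Pointwise-CFLin-unique : ∀ {ws : List (Word n)} {lss lss′} →
    Pointwise IsCFLin ws lss → Pointwise IsCFLin ws lss′ → lss ≡ lss′
  Pointwise-CFLin-unique cfls cfls′ =
    Pointwise-≡⇒≡ (Pointwise.transitive CFLin-unique (Pointwise.symmetric id cfls) cfls′)

  IsCFLin-++⁻ : ∀ {w : Word n} xs {ys} → IsCFLin w (xs ++ ys) →
    IsCFLin (concat xs) xs × IsCFLin (concat ys) ys
  IsCFLin-++⁻ xs (_ , als , lk) with ++⁻ xs als | Linked-++⁻ xs lk
  ... | als₁ , als₂ | lk₁ , lk₂ = (refl , als₁ , lk₁) , (refl , als₂ , lk₂)

  IsCFLin-blocks : ∀ {w : Word n} P → IsCFLin w (concat P) → Pointwise IsCFLin (map concat P) P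
  IsCFLin-blocks []      _   = []
  IsCFLin-blocks (p ∷ P) cfl with IsCFLin-++⁻ p cfl
  ... | cfl₁ , cfl₂ = cfl₁ ∷ IsCFLin-blocks P cfl₂

  groupings⇒blocks : ∀ {cs gs : List (List (Word n))} → Pointwise IsGrouping cs gs →
    ∃ λ P → concat P ≡ concat cs × map concat P ≡ concat gs
  groupings⇒blocks [] = [] , refl , refl
  groupings⇒blocks (((ps , _ , concat-ps≡c , map-ps≡g) , _) ∷ groupings)
    with groupings⇒blocks groupings
  ... | P , concat-P≡cs , map-P≡gs =
    ps ++ P , trans (sym (concat-++ ps P)) (cong₂ _++_ concat-ps≡c concat-P≡cs) ,
              trans (map-++ concat ps P) (cong₂ _++_ map-ps≡g map-P≡gs)

proposition8p1 : (n : ℕ) (w : Word n) → w ≢ [] →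
    (ls : List (Word n)) → IsCFLin w ls →
    (ms : List (Word n)) → IsGroupingOfCFL ls ms →
    (∃ λ (lss : List (List (Word n))) → Pointwise IsCFLin ms lss × concat lss ≡ ls) ×
    (∀ (lss : List (List (Word n))) → Pointwise IsCFLin ms lss → concat lss ≡ ls)
proposition8p1 n w _ ls cfl ms (cs , (concat-cs≡ls , _) , gs , groupings , concat-gs≡ms)
  with groupings⇒blocks groupings
... | P , concat-P≡cs , map-P≡gs =
  (P , P-cfl , concat-P≡ls) ,
  λ lss lss-cfl → trans (cong concat (Pointwise-CFLin-unique lss-cfl P-cfl)) concat-P≡ls
  where
  concat-P≡ls : concat P ≡ ls
  concat-P≡ls = trans concat-P≡cs concat-cs≡ls
  P-cfl : Pointwise IsCFLin ms P
  P-cfl = subst (λ ms → Pointwise IsCFLin ms P) (trans map-P≡gs concat-gs≡ms)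
                (IsCFLin-blocks P (subst (IsCFLin w) (sym concat-P≡ls) cfl))
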